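{- For every context tree $\mathcal{T}$ over $A$, $\overline{C(\mathcal{T})}=\overline{\mathcal{T}}$.
   Context: Fix a finite alphabet $A=\{a_1,\dots,a_n\}$. Strings are finite sequences over $A$; $\overline{uv}$ is concatenation; $v\prec s$ ($v$ is a postfix of $s$) if $s=\overline{wv}$ for some string $w$. A context tree over $A$ is a finite rooted tree whose non-root vertices are labeled by letters of $A$, no two siblings having the same label; a context is the string read along the path from a leaf to the root (leaf's label first), and $\mathcal{T}^*$ is the set of contexts. $\mathcal{T}$ is complete if every node is a leaf or has exactly $n$ children. $\mathcal{A}\subseteq\mathcal{B}$ ("contained at the root") means every $a\in\mathcal{A}^*$ satisfies $a\prec b$ for some $b\in\mathcal{B}^*$. $\mathcal{T}$ has perfect memory if for all $c\in\mathcal{T}^*$ and all $i$ there is $u\in\mathcal{T}^*$ with $u\prec\overline{ca_i}$. $C(\mathcal{T})$ denotes the minimum (with respect to $\subseteq$) complete context tree containing $\mathcal{T}$. The perfect-memory closure $\overline{\mathcal{T}}$ of $\mathcal{T}$ is the intersection at the root of all perfect-memory context trees $\mathcal{G}$ with $\mathcal{T}\subseteq\mathcal{G}$; it is the smallest (with respect to $\subseteq$) perfect-memory context tree containing $\mathcal{T}$. (For complete $\mathcal{A},\mathcal{B}$, the intersection at the root has contexts $\{u\in\mathcal{A}^*: \exists c\in\mathcal{B}^*, u\prec c\}\cup\{u\in\mathcal{B}^*:\exists c\in\mathcal{A}^*, u\prec c\}$.) -}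

module Defs where

open import Data.Nat using (ℕ)
open import Data.Fin using (Fin)
open import Data.List using (List; []; _∷_; [_]; _++_; length; map)
open import Data.List.Membership.Propositional using (_∈_)
open import Data.List.Relation.Unary.Unique.Propositional using (Unique)
open import Data.Product using (_×_; _,_; Σ; ∃; proj₁)
open import Data.Sum using (_⊎_)
open import Data.Unit using (⊤)
open import Relation.Binary.PropositionalEquality using (_≡_)

Str : ℕ → Set
Str n = List (Fin n)

_≺_ : ∀ {n} → Str n → Str n → Set
_≺_ {n} v s = Σ (Str n) λ w → s ≡ w ++ v

-- Raw rooted trees whose non-root vertices are labelled by letters:
-- a node is the list of its (label, subtree) children.
data Tree (n : ℕ) : Set where
  node : List (Fin n × Tree n) → Tree n

mutual
  WF : ∀ {n} → Tree n → Set
  WF (node cs) = Unique (map proj₁ cs) × WFAll cs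

  WFAll : ∀ {n} → List (Fin n × Tree n) → Set
  WFAll [] = ⊤
  WFAll ((_ , t) ∷ cs) = WF t × WFAll cs

record ContextTree (n : ℕ) : Set where
  constructor ctree
  field
    tree : Tree n
    wf   : WF tree
open ContextTree public

-- s ∈ctx t : s is the string read along a path from a leaf of t to the
-- root of t (leaf's label first, label of the root's child last).
data _∈ctxT_ {n : ℕ} : Str n → Tree n → Set where
  leaf : [] ∈ctxT node []
  step : ∀ {cs a t s} → (a , t) ∈ cs → s ∈ctxT t → (s ++ [ a ]) ∈ctxT node cs

_∈ctx_ : ∀ {n} → Str n → ContextTree n → Set
s ∈ctx T = s ∈ctxT tree T

mutual
  CompleteT : ∀ {n} → Tree n → Set
  CompleteT {n} (node cs) = (cs ≡ [] ⊎ length cs ≡ n) × CompleteAll cs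

  CompleteAll : ∀ {n} → List (Fin n × Tree n) → Set
  CompleteAll [] = ⊤
  CompleteAll ((_ , t) ∷ cs) = CompleteT t × CompleteAll cs

Complete : ∀ {n} → ContextTree n → Set
Complete T = CompleteT (tree T)

_⊆_ : ∀ {n} → ContextTree n → ContextTree n → Set
_⊆_ {n} 𝒜 ℬ = ∀ (a : Str n) → a ∈ctx 𝒜 → Σ (Str n) λ b → b ∈ctx ℬ × a ≺ b

PerfectMemory : ∀ {n} → ContextTree n → Set
PerfectMemory {n} T =
  ∀ (c : Str n) → c ∈ctx T → ∀ (i : Fin n) →
    Σ (Str n) λ u → u ∈ctx T × u ≺ (c ++ [ i ])

IsCompletion : ∀ {n} → ContextTree n → ContextTree n → Set
IsCompletion {n} T C =
  Complete C × T ⊆ C ×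
  (∀ (D : ContextTree n) → Complete D → T ⊆ D → C ⊆ D)

IsPMClosure : ∀ {n} → ContextTree n → ContextTree n → Set
IsPMClosure {n} T G =
  PerfectMemory G × T ⊆ G ×
  (∀ (H : ContextTree n) → PerfectMemory H → T ⊆ H → G ⊆ H)

-- Equality of context trees (as sets of contexts, which determine the tree).
_≈T_ : ∀ {n} → ContextTree n → ContextTree n → Set
_≈T_ {n} A B = ∀ (s : Str n) → (s ∈ctx A → s ∈ctx B) × (s ∈ctx B → s ∈ctx A)

-- A perfect-memory tree is complete: below an internal node with path p,
-- take a context c passing through it; reading any letter y and then p again
-- after c leads, by perfect memory, to a context that is a postfix of c y p,
-- and since contexts are postfix-free it cannot be a strict postfix of y p,
-- so the node has a child labelled y. Hence the closure of T is a complete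
-- tree containing T, so it contains C(T) and therefore the closure of C(T);
-- conversely T ⊆ C(T) gives the other inclusion. Finally ⊆ is antisymmetric
-- up to equality of context sets, again because contexts are postfix-free.
module Submission where

open import Data.Nat using (ℕ)
open import Defs

open import Data.Fin using (Fin)
open import Data.List using (List; []; _∷_; [_]; _++_; length; map)
open import Data.List.Properties
  using (++-assoc; ++-identityʳ; ++-conicalʳ; ∷ʳ-injective; ∷-injective; length-map; length-tabulate)
open import Data.List.Membership.Propositional using (_∈_)
open import Data.List.Membership.Propositional.Properties using (∈-map⁺; ∈-allFin)
open import Data.List.Membership.Propositional.Properties.WithK using (unique∧set⇒bag)
open import Data.List.Relation.Unary.Any using (here; there)
open import Data.List.Relation.Unary.All as All using ()
open import Data.List.Relation.Unary.AllPairs using (_∷_)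
open import Data.List.Relation.Unary.Unique.Propositional using (Unique)
open import Data.List.Relation.Unary.Unique.Propositional.Properties using (allFin⁺)
open import Data.List.Relation.Binary.BagAndSetEquality using (∼bag⇒↭)
open import Data.List.Relation.Binary.Permutation.Propositional.Properties using (↭-length)
open import Data.Product using (_×_; _,_; Σ; proj₁; proj₂)
open import Data.Sum using (_⊎_; inj₁; inj₂)
open import Data.Unit using (tt)
open import Data.Empty using (⊥-elim)
open import Function.Bundles using (mk⇔)
open import Relation.Binary.PropositionalEquality
  using (_≡_; _≢_; refl; sym; trans; subst)

module _ {n : ℕ} where

  ∷ʳ≢[] : ∀ (xs : Str n) x → xs ++ [ x ] ≢ []
  ∷ʳ≢[] xs x eq with ++-conicalʳ xs [ x ] eq
  ... | ()

  ≺-trans : ∀ {u v s : Str n} → u ≺ v → v ≺ s → u ≺ s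
  ≺-trans {u} (w₁ , refl) (w₂ , refl) = w₂ ++ w₁ , sym (++-assoc w₂ w₁ u)

  ≺-++ʳ : ∀ {u s : Str n} x → u ≺ s → (u ++ x) ≺ (s ++ x)
  ≺-++ʳ {u} x (w , refl) = w , ++-assoc w u x

  ≺-linear : ∀ {u v s : Str n} → u ≺ s → v ≺ s → v ≺ u ⊎ u ≺ v
  ≺-linear ([] , refl) (w₂ , eq) = inj₁ (w₂ , eq)
  ≺-linear (x ∷ w₁ , refl) ([] , refl) = inj₂ (x ∷ w₁ , refl)
  ≺-linear (x ∷ w₁ , refl) (y ∷ w₂ , eq) = ≺-linear (w₁ , refl) (w₂ , proj₂ (∷-injective eq))

  unique-covering⇒length≡n : ∀ {xs : List (Fin n)} → Unique xs → (∀ y → y ∈ xs) → length xs ≡ n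
  unique-covering⇒length≡n u cover =
    trans (↭-length (∼bag⇒↭ (unique∧set⇒bag u (allFin⁺ n)
            (λ {y} → mk⇔ (λ _ → ∈-allFin y) (λ _ → cover y)))))
          (length-tabulate _)

  Children : Set
  Children = List (Fin n × Tree n)

  same-label⇒same-subtree : ∀ {cs : Children} → Unique (map proj₁ cs) →
    ∀ {a t₁ t₂} → (a , t₁) ∈ cs → (a , t₂) ∈ cs → t₁ ≡ t₂
  same-label⇒same-subtree (_ ∷ _) (here refl) (here refl) = refl
  same-label⇒same-subtree (a∉ ∷ _) (here refl) (there m) = ⊥-elim (All.lookup a∉ (∈-map⁺ proj₁ m) refl)
  same-label⇒same-subtree (a∉ ∷ _) (there m) (here refl) = ⊥-elim (All.lookup a∉ (∈-map⁺ proj₁ m) refl)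
  same-label⇒same-subtree (_ ∷ u) (there m₁) (there m₂) = same-label⇒same-subtree u m₁ m₂

  WFAll-∈ : ∀ {cs : Children} {a t} → WFAll cs → (a , t) ∈ cs → WF t
  WFAll-∈ (w , _) (here refl) = w
  WFAll-∈ (_ , ws) (there m) = WFAll-∈ ws m

  -- Like contexts, a path is read from the subtree up to the root.
  data Path : Str n → Tree n → Tree n → Set where
    here  : ∀ {t} → Path [] t t
    there : ∀ {cs a t p t′} → (a , t) ∈ cs → Path p t′ t → Path (p ++ [ a ]) t′ (node cs)

  ∈ctxT⇒Path : ∀ {s t} → s ∈ctxT t → Path s (node []) t
  ∈ctxT⇒Path leaf = here
  ∈ctxT⇒Path (step m r) = there m (∈ctxT⇒Path r)

  Path⇒∈ctxT : ∀ {s t} → Path s (node []) t → s ∈ctxT t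
  Path⇒∈ctxT here = leaf
  Path⇒∈ctxT (there m P) = step m (Path⇒∈ctxT P)

  Path-++ : ∀ {q p t″ t′ t} → Path q t″ t′ → Path p t′ t → Path (q ++ p) t″ t
  Path-++ {q} Q here = subst (λ r → Path r _ _) (sym (++-identityʳ q)) Q
  Path-++ {q} Q (there {a = a} {p = p} m P) =
    subst (λ r → Path r _ _) (++-assoc q p [ a ]) (there m (Path-++ Q P))

  Path-child : ∀ {p cs t a t′} → Path p (node cs) t → (a , t′) ∈ cs → Path (a ∷ p) t′ t
  Path-child P m = Path-++ (there m here) P

  Path-WF : ∀ {p t′ t} → WF t → Path p t′ t → WF t′
  Path-WF wf here = wf
  Path-WF (_ , wfs) (there m P) = Path-WF (WFAll-∈ wfs m) P

  -- Labels of siblings are distinct, so a path determines the subtree it leads to.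
  Path-suffix : ∀ {p t′ t} → WF t → Path p t′ t →
    ∀ {z t″} q → Path z t″ t → z ≡ q ++ p → Path q t″ t′
  Path-suffix wf here q Z eq = subst (λ r → Path r _ _) (trans eq (++-identityʳ q)) Z
  Path-suffix wf (there {a = a} {p = p} m P) q here eq =
    ⊥-elim (∷ʳ≢[] p a (++-conicalʳ q _ (sym eq)))
  Path-suffix (u , wfs) (there {a = a} {p = p} m P) q (there {p = z} m′ Z) eq
    with ∷ʳ-injective z (q ++ p) (trans eq (sym (++-assoc q p [ a ])))
  ... | eq′ , refl with same-label⇒same-subtree u m m′
  ... | refl = Path-suffix (WFAll-∈ wfs m) P q Z eq′

  Path-last : ∀ {cs : Children} {z t″} w y → Path z t″ (node cs) → z ≡ w ++ [ y ] →
    Σ (Tree n) λ t → (y , t) ∈ cs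
  Path-last w y here eq = ⊥-elim (∷ʳ≢[] w y (sym eq))
  Path-last w y (there {t = t} {p = p} m _) eq with ∷ʳ-injective p w eq
  ... | _ , refl = t , m

  context-through-child : ∀ {t p cs} → WF t → Path p (node cs) t →
    ∀ w {y} → (w ++ y ∷ p) ∈ctxT t → Σ (Tree n) λ t′ → (y , t′) ∈ cs
  context-through-child {p = p} wf P w {y} r =
    Path-last w y (Path-suffix wf P (w ++ [ y ]) (∈ctxT⇒Path r) (sym (++-assoc w [ y ] p))) refl

  Path-leaf : ∀ {w} → Path w (node []) (node []) → w ≡ []
  Path-leaf here = refl

  ∈ctxT-postfix-free : ∀ {t a b} → WF t → a ∈ctxT t → b ∈ctxT t → ∀ w → b ≡ w ++ a → w ≡ []
  ∈ctxT-postfix-free wf ra rb w eq =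
    Path-leaf (Path-suffix wf (∈ctxT⇒Path ra) w (∈ctxT⇒Path rb) eq)

  some-context : (t : Tree n) → Σ (Str n) λ s → s ∈ctxT t
  some-context (node []) = [] , leaf
  some-context (node ((a , t) ∷ _)) with some-context t
  ... | s , r = s ++ [ a ] , step (here refl) r

  PerfectMemory-++ : ∀ {G : ContextTree n} → PerfectMemory G → ∀ {c} → c ∈ctx G → ∀ x →
    Σ (Str n) λ u → u ∈ctx G × u ≺ (c ++ x)
  PerfectMemory-++ pm {c} r [] = c , r , [] , ++-identityʳ c
  PerfectMemory-++ {G} pm {c} r (i ∷ x) with pm c r i
  ... | u₁ , r₁ , u₁≺ci with PerfectMemory-++ {G} pm r₁ x
  ... | u , r , u≺u₁x =
    u , r , subst (u ≺_) (++-assoc c [ i ] x) (≺-trans u≺u₁x (≺-++ʳ x u₁≺ci))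

  module _ {G : ContextTree n} (pm : PerfectMemory G) where

    node-through-context-total : ∀ {p cs} → Path p (node cs) (tree G) →
      ∀ s₀ a₀ → (s₀ ++ a₀ ∷ p) ∈ctx G → ∀ y → Σ (Tree n) λ t → (y , t) ∈ cs
    node-through-context-total {p} P s₀ a₀ c∈G y
      with PerfectMemory-++ {G} pm c∈G (y ∷ p)
    ... | u , u∈G , u≺cyp with ≺-linear u≺cyp (s₀ ++ a₀ ∷ p , refl)
    ... | inj₁ (w , refl) = context-through-child (wf G) P w u∈G
    ... | inj₂ ([] , refl) = context-through-child (wf G) P [] u∈G
    -- Otherwise u is a strict postfix of p, hence of the context c.
    ... | inj₂ (x ∷ w , yp≡) with refl ← proj₂ (∷-injective yp≡)
      with ++-conicalʳ s₀ (a₀ ∷ w)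
             (∈ctxT-postfix-free (wf G) u∈G c∈G (s₀ ++ a₀ ∷ w) (sym (++-assoc s₀ (a₀ ∷ w) u)))
    ... | ()

    internal-node-total : ∀ {p cs a₀ t₀} → Path p (node cs) (tree G) → (a₀ , t₀) ∈ cs →
      ∀ y → Σ (Tree n) λ t → (y , t) ∈ cs
    internal-node-total {t₀ = t₀} P m₀ with some-context t₀
    ... | s₀ , r₀ =
      node-through-context-total P s₀ _ (Path⇒∈ctxT (Path-++ (∈ctxT⇒Path r₀) (Path-child P m₀)))

    mutual
      Path⇒CompleteT : ∀ {p t′} → Path p t′ (tree G) → CompleteT t′
      Path⇒CompleteT {t′ = node []} P = inj₁ refl , tt
      Path⇒CompleteT {t′ = node cs@(_ ∷ _)} P =
        inj₂ (trans (sym (length-map proj₁ cs))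
          (unique-covering⇒length≡n (proj₁ (Path-WF (wf G) P))
            (λ y → ∈-map⁺ proj₁ (proj₂ (internal-node-total P (here refl) y))))) ,
        Path⇒CompleteAll (Path-child P)

      Path⇒CompleteAll : ∀ {p cs} → (∀ {a t′} → (a , t′) ∈ cs → Path (a ∷ p) t′ (tree G)) →
        CompleteAll cs
      Path⇒CompleteAll {cs = []} P = tt
      Path⇒CompleteAll {cs = _ ∷ _} P = Path⇒CompleteT (P (here refl)) , Path⇒CompleteAll (λ m → P (there m))

    PerfectMemory⇒Complete : Complete G
    PerfectMemory⇒Complete = Path⇒CompleteT here

  ⊆-trans : ∀ {A B C : ContextTree n} → A ⊆ B → B ⊆ C → A ⊆ C
  ⊆-trans A⊆B B⊆C a a∈A with A⊆B a a∈A
  ... | b , b∈B , a≺b with B⊆C b b∈B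
  ... | c , c∈C , b≺c = c , c∈C , ≺-trans a≺b b≺c

  ⊆∧⊇⇒∈ctx : ∀ {A B : ContextTree n} → A ⊆ B → B ⊆ A → ∀ {s} → s ∈ctx A → s ∈ctx B
  ⊆∧⊇⇒∈ctx {A} A⊆B B⊆A {s} s∈A with A⊆B s s∈A
  ... | b , b∈B , (w₁ , refl) with B⊆A b b∈B
  ... | a , a∈A , (w₂ , refl)
    with refl ← ++-conicalʳ w₂ w₁
                  (∈ctxT-postfix-free (wf A) s∈A a∈A (w₂ ++ w₁) (sym (++-assoc w₂ w₁ s)))
    = b∈B

  ⊆-antisym : ∀ {A B : ContextTree n} → A ⊆ B → B ⊆ A → A ≈T B
  ⊆-antisym {A} {B} A⊆B B⊆A s = ⊆∧⊇⇒∈ctx {A} {B} A⊆B B⊆A , ⊆∧⊇⇒∈ctx {B} {A} B⊆A A⊆B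

mainTheorem5 : ∀ (n : ℕ) (T CT G₁ G₂ : ContextTree n) →
    IsCompletion T CT → IsPMClosure CT G₁ → IsPMClosure T G₂ → G₁ ≈T G₂
mainTheorem5 n T CT G₁ G₂ (_ , T⊆CT , CT-least) (pm₁ , CT⊆G₁ , G₁-least) (pm₂ , T⊆G₂ , G₂-least) =
  ⊆-antisym {A = G₁} {B = G₂} G₁⊆G₂ G₂⊆G₁
  where
  G₂⊆G₁ : G₂ ⊆ G₁
  G₂⊆G₁ = G₂-least G₁ pm₁ (⊆-trans {A = T} {B = CT} {C = G₁} T⊆CT CT⊆G₁)
  G₁⊆G₂ : G₁ ⊆ G₂
  G₁⊆G₂ = G₁-least G₂ pm₂ (CT-least G₂ (PerfectMemory⇒Complete {G = G₂} pm₂) T⊆G₂)
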